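{- Let $T\ge1$, $\mathcal{T}=\{1,\dots,T\}$, and let $A_0,\dots,A_T$ and $B_0,\dots,B_T$ be integer sequences that each satisfy $Z_0=0$ and $Z_{t-1}\le Z_t\le Z_{t-1}+1$ for all $t\in\mathcal{T}$. Let $t^\star\in\mathcal{T}$ satisfy $A_{t^\star-1}<B_{t^\star}$, and let $$t_A=\max\{t\in\{0,1,\dots,T\}: A_t=A_{t^\star-1}\}+1,\qquad t_B=\min\{t\in\mathcal{T}: B_t=B_{t^\star}\},$$ $$A^\star_t=\begin{cases}A_t & t<t_A\\ A_t-1 & t\ge t_A\end{cases}\qquad B^\star_t=\begin{cases}B_t & t<t_B\\ B_t-1 & t\ge t_B\end{cases}\qquad (t=0,\dots,T).$$ Then the sequences $(A^\star_t)_{t=0}^T$ and $(B^\star_t)_{t=0}^T$ also satisfy $Z_0=0$ and $Z_{t-1}\le Z_t\le Z_{t-1}+1$ for all $t\in\mathcal{T}$, and for every sequence $x_1,\dots,x_T\in\{0,1\}$ with $x_{t^\star}=1$, the condition $A_t\le\sum_{i=1}^t x_i\le B_t$ for all $t\in\mathcal{T}$ holds if and only if $$A^\star_t\le \sum_{\substack{i=1\\ i\ne t^\star}}^{t}x_i\le B^\star_t\quad\text{for every } t\in\mathcal{T}.$$ -}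

module Defs where

open import Data.Nat as ℕ using (ℕ; zero; suc; _<?_; _≟_)
open import Data.Integer as ℤ using (ℤ; +_; _+_; _-_; _≤_)
open import Data.Maybe using (Maybe; just; nothing; fromMaybe)
open import Data.Product using (_×_)
open import Relation.Binary.PropositionalEquality using (_≡_)
open import Relation.Nullary using (yes; no)

-- Z_0 = 0 and Z_{t-1} ≤ Z_t ≤ Z_{t-1}+1 for all t ∈ {1,…,T}
-- (sequences are functions ℕ → ℤ; only indices 0..T matter)
Admissible : ℕ → (ℕ → ℤ) → Set
Admissible T Z = (Z 0 ≡ + 0) ×
  (∀ s → suc s ℕ.≤ T → (Z s ≤ Z (suc s)) × (Z (suc s) ≤ Z s + + 1))

-- lastEq Z v n = max { t ∈ {0,…,n} : Z t = v }   (0 if the set is empty)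
lastEq : (ℕ → ℤ) → ℤ → ℕ → ℕ
lastEq Z v zero = 0
lastEq Z v (suc n) with Z (suc n) ℤ.≟ v
... | yes _ = suc n
... | no _ = lastEq Z v n

firstEq : (ℕ → ℤ) → ℤ → ℕ → Maybe ℕ
firstEq Z v zero = nothing
firstEq Z v (suc n) with firstEq Z v n
... | just k = just k
... | nothing with Z (suc n) ℤ.≟ v
...   | yes _ = just (suc n)
...   | no _ = nothing

tA : ℕ → (ℕ → ℤ) → ℕ → ℕ
tA T A t⋆ = suc (lastEq A (A (t⋆ ℕ.∸ 1)) T)

-- t_B = min{t ∈ {1..T} : B_t = B_{t*}}  (set is nonempty when 1 ≤ t* ≤ T;
-- the fallback value T is never used in that case)
tB : ℕ → (ℕ → ℤ) → ℕ → ℕ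
tB T B t⋆ = fromMaybe T (firstEq B (B t⋆) T)

shiftFrom : ℕ → (ℕ → ℤ) → ℕ → ℤ
shiftFrom c Z t with t <? c
... | yes _ = Z t
... | no _ = Z t - + 1

psum : (ℕ → ℕ) → ℕ → ℕ
psum x zero = 0
psum x (suc t) = psum x t ℕ.+ x (suc t)

psumExcl : ℕ → (ℕ → ℕ) → ℕ → ℕ
psumExcl t⋆ x zero = 0
psumExcl t⋆ x (suc t) with suc t ≟ t⋆
... | yes _ = psumExcl t⋆ x t
... | no _ = psumExcl t⋆ x t ℕ.+ x (suc t)

-- Deleting the forced term x_{t⋆} = 1 lowers the partial sum S_t by one exactly for t ≥ t⋆,
-- while A⋆ is lowered from t_A ≥ t⋆ on and B⋆ from t_B ≤ t⋆ on.  On [t⋆, t_A) the lower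
-- bound is not lowered, but there A_t = A_{t⋆-1} ≤ S_{t⋆-1} ≤ S_t − 1; on [t_B, t⋆) the upper
-- bound is lowered although the sum is not, but there S_t + 1 ≤ S_{t⋆} ≤ B_{t⋆} = B_t.
-- The shifted sequences stay admissible because each is lowered from a step where it strictly
-- increases: A leaves the level A_{t⋆-1} at t_A, and B first reaches B_{t⋆} at t_B (for t_B = 1
-- this is B_0 = 0 ≤ A_{t⋆-1} < B_{t⋆}).

module Submission where

open import Defs
open import Data.Nat using (ℕ; suc; _∸_) renaming (_≤_ to _≤ℕ_)
open import Data.Integer using (ℤ; +_; _<_; _≤_)
open import Data.Product using (_×_)
open import Function.Bundles using (_⇔_)
open import Relation.Binary.PropositionalEquality using (_≡_)

open import Data.Nat as ℕ using (zero; z≤n; s≤s)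
import Data.Nat.Properties as ℕₚ
open import Data.Integer as ℤ using (pred)
import Data.Integer.Properties as ℤₚ
open import Data.Maybe using (Maybe; just; nothing; fromMaybe)
open import Data.Product using (_,_; proj₁; proj₂)
open import Data.Sum using (inj₁; inj₂)
open import Data.Empty using (⊥-elim)
open import Function.Bundles using (mk⇔)
open import Relation.Nullary using (yes; no)
open import Relation.Binary.Definitions using (tri<; tri≈; tri>)
open import Relation.Binary.PropositionalEquality
  using (refl; sym; trans; cong; subst; subst₂; _≢_)
open import Function using (_∘_)

private
  variable
    T c k p s t : ℕ
    i j v : ℤ
    x : ℕ → ℕ
    Z U : ℕ → ℤ

pred-cancel-≤ : pred i ≤ pred j → i ≤ j
pred-cancel-≤ {i} {j} h = subst₂ _≤_ (ℤₚ.suc-pred i) (ℤₚ.suc-pred j) (ℤₚ.suc-mono h)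

pred≤ : ∀ i → pred i ≤ i
pred≤ i = ℤₚ.i≤j⇒pred[i]≤j ℤₚ.≤-refl

i-1≡pred[i] : ∀ i → i ℤ.- + 1 ≡ pred i
i-1≡pred[i] i = ℤₚ.+-comm i ℤ.-1ℤ

admissible-mono : Admissible T Z → ∀ {s t} → s ≤ℕ t → t ≤ℕ T → Z s ≤ Z t
admissible-mono adm {t = zero} z≤n _ = ℤₚ.≤-refl
admissible-mono adm {s} {suc t} s≤1+t 1+t≤T with ℕₚ.m≤n⇒m<n∨m≡n s≤1+t
... | inj₂ refl = ℤₚ.≤-refl
... | inj₁ (s≤s s≤t) =
  ℤₚ.≤-trans (admissible-mono adm s≤t (ℕₚ.<⇒≤ 1+t≤T)) (proj₁ (proj₂ adm t 1+t≤T))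

admissible-jump : Admissible T Z → suc s ≤ℕ T → Z s ≢ Z (suc s) → Z s < Z (suc s)
admissible-jump (_ , steps) 1+s≤T = ℤₚ.≤∧≢⇒< (proj₁ (steps _ 1+s≤T))

shiftFrom-< : t ℕ.< c → shiftFrom c Z t ≡ Z t
shiftFrom-< {t} {c} t<c with t ℕ.<? c
... | yes _ = refl
... | no t≮c = ⊥-elim (t≮c t<c)

shiftFrom-≥ : c ≤ℕ t → shiftFrom c Z t ≡ pred (Z t)
shiftFrom-≥ {c} {t} {Z} c≤t with t ℕ.<? c
... | yes t<c = ⊥-elim (ℕₚ.<⇒≱ t<c c≤t)
... | no _ = i-1≡pred[i] (Z t)

shiftFrom-admissible : Admissible T Z → 1 ≤ℕ c → (c ≤ℕ T → Z (c ∸ 1) < Z c) →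
  Admissible T (shiftFrom c Z)
shiftFrom-admissible {T} {Z} {suc c} (Z0≡0 , steps) (s≤s z≤n) jump = Z0≡0 , steps′
  where
  steps′ : ∀ s → suc s ≤ℕ T →
    (shiftFrom (suc c) Z s ≤ shiftFrom (suc c) Z (suc s)) ×
    (shiftFrom (suc c) Z (suc s) ≤ shiftFrom (suc c) Z s ℤ.+ + 1)
  steps′ s 1+s≤T with ℕₚ.<-cmp s c | steps s 1+s≤T
  ... | tri< s<c _ _ | step
    rewrite shiftFrom-< {Z = Z} (ℕₚ.m<n⇒m<1+n s<c) | shiftFrom-< {Z = Z} (s≤s s<c) = step
  ... | tri≈ _ refl _ | (_ , up)
    rewrite shiftFrom-< {Z = Z} (ℕₚ.n<1+n s) | shiftFrom-≥ {Z = Z} (ℕₚ.≤-refl {suc s}) =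
    ℤₚ.i<j⇒i≤pred[j] (jump 1+s≤T) , ℤₚ.≤-trans (pred≤ _) up
  ... | tri> _ _ c<s | (mono , up)
    rewrite shiftFrom-≥ {Z = Z} c<s | shiftFrom-≥ {Z = Z} (ℕₚ.m<n⇒m<1+n c<s) =
    ℤₚ.pred-mono mono ,
    subst (pred (Z (suc s)) ≤_) (sym (ℤₚ.pred-+ (Z s) (+ 1))) (ℤₚ.pred-mono up)

lastEq≤ : ∀ Z v n → lastEq Z v n ≤ℕ n
lastEq≤ Z v zero = z≤n
lastEq≤ Z v (suc n) with Z (suc n) ℤ.≟ v
... | yes _ = ℕₚ.≤-refl
... | no _ = ℕₚ.m≤n⇒m≤1+n (lastEq≤ Z v n)

lastEq-maximal : ∀ Z v n → s ≤ℕ n → Z s ≡ v → s ≤ℕ lastEq Z v n × Z (lastEq Z v n) ≡ v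
lastEq-maximal Z v zero z≤n Zs≡v = z≤n , Zs≡v
lastEq-maximal {s} Z v (suc n) s≤1+n Zs≡v with Z (suc n) ℤ.≟ v
... | yes Z[1+n]≡v = s≤1+n , Z[1+n]≡v
... | no Z[1+n]≢v with ℕₚ.m≤n⇒m<n∨m≡n s≤1+n
...   | inj₁ (s≤s s≤n) = lastEq-maximal Z v n s≤n Zs≡v
...   | inj₂ refl = ⊥-elim (Z[1+n]≢v Zs≡v)

lastEq-last : ∀ Z v n → lastEq Z v n ℕ.< t → t ≤ℕ n → Z t ≢ v
lastEq-last Z v zero last<t t≤0 = ⊥-elim (ℕₚ.<⇒≱ last<t t≤0)
lastEq-last {t} Z v (suc n) last<t t≤1+n with Z (suc n) ℤ.≟ v
... | yes _ = ⊥-elim (ℕₚ.<⇒≱ last<t t≤1+n)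
... | no Z[1+n]≢v with ℕₚ.m≤n⇒m<n∨m≡n t≤1+n
...   | inj₁ (s≤s t≤n) = lastEq-last Z v n last<t t≤n
...   | inj₂ refl = Z[1+n]≢v

record FirstVisit (Z : ℕ → ℤ) (v : ℤ) (k : ℕ) : Set where
  field
    positive  : 1 ≤ℕ k
    visit     : Z k ≡ v
    unvisited : ∀ s → 1 ≤ℕ s → s ℕ.< k → Z s ≢ v

FirstEqSpec : (ℕ → ℤ) → ℤ → ℕ → Maybe ℕ → Set
FirstEqSpec Z v n nothing = ∀ t → 1 ≤ℕ t → t ≤ℕ n → Z t ≢ v
FirstEqSpec Z v n (just k) = k ≤ℕ n × FirstVisit Z v k

firstEq-spec : ∀ Z v n → FirstEqSpec Z v n (firstEq Z v n)
firstEq-spec Z v zero t 1≤t t≤0 = ⊥-elim (ℕₚ.<⇒≱ 1≤t t≤0)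
firstEq-spec Z v (suc n) with firstEq Z v n | firstEq-spec Z v n
... | just k | (k≤n , first) = ℕₚ.m≤n⇒m≤1+n k≤n , first
... | nothing | absent with Z (suc n) ℤ.≟ v
...   | yes Z[1+n]≡v =
  ℕₚ.≤-refl , record
    { positive = s≤s z≤n
    ; visit = Z[1+n]≡v
    ; unvisited = λ t 1≤t t<1+n → absent t 1≤t (ℕₚ.≤-pred t<1+n)
    }
...   | no Z[1+n]≢v = absent′
  where
  absent′ : ∀ t → 1 ≤ℕ t → t ≤ℕ suc n → Z t ≢ v
  absent′ t 1≤t t≤1+n with ℕₚ.m≤n⇒m<n∨m≡n t≤1+n
  ... | inj₁ (s≤s t≤n) = absent t 1≤t t≤n
  ... | inj₂ refl = Z[1+n]≢v

firstEq-visit : ∀ Z v n → 1 ≤ℕ t → t ≤ℕ n → Z t ≡ v →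
  FirstVisit Z v (fromMaybe n (firstEq Z v n)) × fromMaybe n (firstEq Z v n) ≤ℕ t
firstEq-visit {t} Z v n 1≤t t≤n Zt≡v with firstEq Z v n | firstEq-spec Z v n
... | nothing | absent = ⊥-elim (absent t 1≤t t≤n Zt≡v)
... | just k | (_ , first) =
  first , ℕₚ.≮⇒≥ (λ t<k → FirstVisit.unvisited first t 1≤t t<k Zt≡v)

first-visit-jump : Admissible T Z → Z 0 ≢ v → k ≤ℕ T → FirstVisit Z v k → Z (k ∸ 1) < Z k
first-visit-jump {Z = Z} {v = v} {k = suc k} adm Z0≢v k≤T first =
  admissible-jump adm k≤T λ Zk≡Z[1+k] → before-visit k ℕₚ.≤-refl (trans Zk≡Z[1+k] visit)
  where
  open FirstVisit first
  before-visit : ∀ s → s ℕ.< suc k → Z s ≢ v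
  before-visit zero _ = Z0≢v
  before-visit (suc s) s<k = unvisited (suc s) (s≤s z≤n) s<k

-- From here on, p stands for t⋆ − 1.
module _ {T p : ℕ} {A : ℕ → ℤ} (admA : Admissible T A) (1+p≤T : suc p ≤ℕ T) where

  private
    L : ℕ
    L = lastEq A (A p) T

    last-visit : p ≤ℕ L × A L ≡ A p
    last-visit = lastEq-maximal A (A p) T (ℕₚ.<⇒≤ 1+p≤T) refl

  t⋆≤tA : suc p ≤ℕ tA T A (suc p)
  t⋆≤tA = s≤s (proj₁ last-visit)

  tA-plateau : ∀ s → s ℕ.< tA T A (suc p) → A s ≤ A p
  tA-plateau s (s≤s s≤L) = subst (A s ≤_) (proj₂ last-visit)
    (admissible-mono admA s≤L (lastEq≤ A (A p) T))

  tA-jump : tA T A (suc p) ≤ℕ T → A (tA T A (suc p) ∸ 1) < A (tA T A (suc p))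
  tA-jump tA≤T = admissible-jump admA tA≤T λ AL≡A[1+L] →
    lastEq-last A (A p) T (ℕₚ.n<1+n L) tA≤T (trans (sym AL≡A[1+L]) (proj₂ last-visit))

module _ {T p : ℕ} {B : ℕ → ℤ} (admB : Admissible T B) (1+p≤T : suc p ≤ℕ T) where

  private
    first-visit : FirstVisit B (B (suc p)) (tB T B (suc p)) × tB T B (suc p) ≤ℕ suc p
    first-visit = firstEq-visit B (B (suc p)) T (s≤s z≤n) 1+p≤T refl

  1≤tB : 1 ≤ℕ tB T B (suc p)
  1≤tB = FirstVisit.positive (proj₁ first-visit)

  tB≤t⋆ : tB T B (suc p) ≤ℕ suc p
  tB≤t⋆ = proj₂ first-visit

  tB-plateau : ∀ s → tB T B (suc p) ≤ℕ s → s ℕ.< suc p → B (suc p) ≤ B s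
  tB-plateau s tB≤s s<1+p = subst (_≤ B s) (FirstVisit.visit (proj₁ first-visit))
    (admissible-mono admB tB≤s (ℕₚ.≤-trans (ℕₚ.<⇒≤ s<1+p) 1+p≤T))

  tB-jump : B 0 < B (suc p) → tB T B (suc p) ≤ℕ T →
    B (tB T B (suc p) ∸ 1) < B (tB T B (suc p))
  tB-jump B0<B[1+p] tB≤T =
    first-visit-jump admB (ℤₚ.<⇒≢ B0<B[1+p]) tB≤T (proj₁ first-visit)

psum-mono : ∀ x → s ≤ℕ t → psum x s ≤ℕ psum x t
psum-mono {t = zero} x z≤n = ℕₚ.≤-refl
psum-mono {s} {t = suc t} x s≤1+t with ℕₚ.m≤n⇒m<n∨m≡n s≤1+t
... | inj₁ (s≤s s≤t) = ℕₚ.≤-trans (psum-mono x s≤t) (ℕₚ.m≤m+n (psum x t) (x (suc t)))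
... | inj₂ refl = ℕₚ.≤-refl

psum-step-one : x (suc t) ≡ 1 → psum x (suc t) ≡ suc (psum x t)
psum-step-one {x} {t} x[1+t]≡1 =
  trans (cong (psum x t ℕ.+_) x[1+t]≡1) (ℕₚ.+-comm (psum x t) 1)

psumExcl-< : ∀ x → t ℕ.< p → psumExcl p x t ≡ psum x t
psumExcl-< {t = zero} x _ = refl
psumExcl-< {t = suc t} {p} x 1+t<p with suc t ℕ.≟ p
... | yes refl = ⊥-elim (ℕₚ.<-irrefl refl 1+t<p)
... | no _ = cong (ℕ._+ x (suc t)) (psumExcl-< x (ℕₚ.<-trans (ℕₚ.n<1+n t) 1+t<p))

psum≡suc[psumExcl] : ∀ x → x (suc p) ≡ 1 → suc p ≤ℕ t →
  psum x t ≡ suc (psumExcl (suc p) x t)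
psum≡suc[psumExcl] {p} {t = suc t} x x⋆ 1+p≤1+t with suc t ℕ.≟ suc p
... | yes refl =
  trans (psum-step-one {x} x⋆) (cong suc (sym (psumExcl-< x (ℕₚ.n<1+n t))))
... | no 1+t≢1+p = cong (ℕ._+ x (suc t))
  (psum≡suc[psumExcl] x x⋆ (ℕₚ.≤-pred (ℕₚ.≤∧≢⇒< 1+p≤1+t (1+t≢1+p ∘ sym))))

data Region (a b t : ℕ) : Set where
  before  : t ℕ.< a → Region a b t
  between : a ≤ℕ t → t ℕ.< b → Region a b t
  after   : b ≤ℕ t → Region a b t

region : ∀ {a b} t → Region a b t
region {a} {b} t with t ℕ.<? a | t ℕ.<? b
... | yes t<a | _       = before t<a
... | no t≮a  | yes t<b = between (ℕₚ.≮⇒≥ t≮a) t<b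
... | no _    | no t≮b  = after (ℕₚ.≮⇒≥ t≮b)

module _ (x : ℕ → ℕ) {p : ℕ} (x⋆ : x (suc p) ≡ 1) where

  private
    S S′ : ℕ → ℤ
    S t = + psum x t
    S′ t = + psumExcl (suc p) x t

    S′≡S : t ℕ.< suc p → S′ t ≡ S t
    S′≡S t<1+p = cong +_ (psumExcl-< x t<1+p)

    S′≡pred[S] : suc p ≤ℕ t → S′ t ≡ pred (S t)
    S′≡pred[S] 1+p≤t = cong (pred ∘ +_) (sym (psum≡suc[psumExcl] x x⋆ 1+p≤t))

    S[p]≤S′ : suc p ≤ℕ t → S p ≤ S′ t
    S[p]≤S′ {t} 1+p≤t = ℤ.+≤+ (ℕₚ.≤-pred (begin
      suc (psum x p)              ≡⟨ sym (psum-step-one {x} x⋆) ⟩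
      psum x (suc p)              ≤⟨ psum-mono x 1+p≤t ⟩
      psum x t                    ≡⟨ psum≡suc[psumExcl] x x⋆ 1+p≤t ⟩
      suc (psumExcl (suc p) x t)  ∎))
      where open ℕₚ.≤-Reasoning

    S′≤S : suc p ≤ℕ t → S′ t ≤ S t
    S′≤S {t} 1+p≤t = subst (_≤ S t) (sym (S′≡pred[S] 1+p≤t)) (pred≤ (S t))

    suc[S]≤S[t⋆] : t ℕ.< suc p → ℤ.suc (S t) ≤ S (suc p)
    suc[S]≤S[t⋆] {t} t<1+p = ℤ.+≤+ (subst (suc (psum x t) ℕ.≤_) (sym (psum-step-one {x} x⋆))
      (s≤s (psum-mono x (ℕₚ.≤-pred t<1+p))))

  lower-shift⇒ : ∀ {Z c} → suc p ≤ℕ c → (∀ s → s ℕ.< c → Z s ≤ Z p) → Z p ≤ S p →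
    ∀ t → Z t ≤ S t → shiftFrom c Z t ≤ S′ t
  lower-shift⇒ {Z} {c} 1+p≤c plateau Zp≤ t Zt≤ with region {suc p} {c} t
  ... | before t<1+p =
    subst₂ _≤_ (sym (shiftFrom-< (ℕₚ.<-≤-trans t<1+p 1+p≤c))) (sym (S′≡S t<1+p)) Zt≤
  ... | between 1+p≤t t<c = subst (_≤ S′ t) (sym (shiftFrom-< t<c))
    (ℤₚ.≤-trans (plateau t t<c) (ℤₚ.≤-trans Zp≤ (S[p]≤S′ 1+p≤t)))
  ... | after c≤t = subst₂ _≤_ (sym (shiftFrom-≥ c≤t))
    (sym (S′≡pred[S] (ℕₚ.≤-trans 1+p≤c c≤t))) (ℤₚ.pred-mono Zt≤)

  lower-shift⇐ : ∀ {Z c} → suc p ≤ℕ c → ∀ t → shiftFrom c Z t ≤ S′ t → Z t ≤ S t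
  lower-shift⇐ {Z} {c} 1+p≤c t Z⋆t≤ with region {suc p} {c} t
  ... | before t<1+p =
    subst₂ _≤_ (shiftFrom-< (ℕₚ.<-≤-trans t<1+p 1+p≤c)) (S′≡S t<1+p) Z⋆t≤
  ... | between 1+p≤t t<c =
    ℤₚ.≤-trans (subst (_≤ S′ t) (shiftFrom-< t<c) Z⋆t≤) (S′≤S 1+p≤t)
  ... | after c≤t = pred-cancel-≤
    (subst₂ _≤_ (shiftFrom-≥ c≤t) (S′≡pred[S] (ℕₚ.≤-trans 1+p≤c c≤t)) Z⋆t≤)

  upper-shift⇒ : ∀ {Z k} → k ≤ℕ suc p → (∀ s → k ≤ℕ s → s ℕ.< suc p → Z (suc p) ≤ Z s) →
    S (suc p) ≤ Z (suc p) → ∀ t → S t ≤ Z t → S′ t ≤ shiftFrom k Z t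
  upper-shift⇒ {Z} {k} k≤1+p plateau ≤Z[1+p] t ≤Zt with region {k} {suc p} t
  ... | before t<k =
    subst₂ _≤_ (sym (S′≡S (ℕₚ.<-≤-trans t<k k≤1+p))) (sym (shiftFrom-< t<k)) ≤Zt
  ... | between k≤t t<1+p = subst₂ _≤_ (sym (S′≡S t<1+p)) (sym (shiftFrom-≥ k≤t))
    (ℤₚ.pred-mono (ℤₚ.≤-trans (suc[S]≤S[t⋆] t<1+p)
      (ℤₚ.≤-trans ≤Z[1+p] (plateau t k≤t t<1+p))))
  ... | after 1+p≤t = subst₂ _≤_ (sym (S′≡pred[S] 1+p≤t))
    (sym (shiftFrom-≥ (ℕₚ.≤-trans k≤1+p 1+p≤t))) (ℤₚ.pred-mono ≤Zt)

  upper-shift⇐ : ∀ {Z k} → k ≤ℕ suc p → ∀ t → S′ t ≤ shiftFrom k Z t → S t ≤ Z t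
  upper-shift⇐ {Z} {k} k≤1+p t ≤Z⋆t with region {k} {suc p} t
  ... | before t<k =
    subst₂ _≤_ (S′≡S (ℕₚ.<-≤-trans t<k k≤1+p)) (shiftFrom-< t<k) ≤Z⋆t
  ... | between k≤t t<1+p =
    ℤₚ.≤-trans (subst₂ _≤_ (S′≡S t<1+p) (shiftFrom-≥ k≤t) ≤Z⋆t) (pred≤ (Z t))
  ... | after 1+p≤t = pred-cancel-≤
    (subst₂ _≤_ (S′≡pred[S] 1+p≤t) (shiftFrom-≥ (ℕₚ.≤-trans k≤1+p 1+p≤t)) ≤Z⋆t)

Within : ℕ → (lower upper : ℕ → ℤ) → (ℕ → ℕ) → Set
Within T L U S = ∀ t → 1 ≤ℕ t → t ≤ℕ T → (L t ≤ + S t) × (+ S t ≤ U t)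

within⇒lower-bound : Z 0 ≡ + 0 → Within T Z U (psum x) → t ≤ℕ T → Z t ≤ + psum x t
within⇒lower-bound {t = zero} Z0≡0 _ _ = ℤₚ.≤-reflexive Z0≡0
within⇒lower-bound {t = suc t} _ bounds 1+t≤T = proj₁ (bounds (suc t) (s≤s z≤n) 1+t≤T)

lemma3 : (T : ℕ) → 1 ≤ℕ T → (A B : ℕ → ℤ) → Admissible T A → Admissible T B →
    (t⋆ : ℕ) → 1 ≤ℕ t⋆ → t⋆ ≤ℕ T → A (t⋆ ∸ 1) < B t⋆ →
    Admissible T (shiftFrom (tA T A t⋆) A) × Admissible T (shiftFrom (tB T B t⋆) B) ×
    ((x : ℕ → ℕ) → (∀ i → 1 ≤ℕ i → i ≤ℕ T → x i ≤ℕ 1) → x t⋆ ≡ 1 →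
      ((∀ t → 1 ≤ℕ t → t ≤ℕ T → (A t ≤ + psum x t) × (+ psum x t ≤ B t)) ⇔
       (∀ t → 1 ≤ℕ t → t ≤ℕ T →
          (shiftFrom (tA T A t⋆) A t ≤ + psumExcl t⋆ x t) ×
          (+ psumExcl t⋆ x t ≤ shiftFrom (tB T B t⋆) B t))))
lemma3 T _ A B admA admB (suc p) _ t⋆≤T Ap<Bt⋆ =
  shiftFrom-admissible admA (s≤s z≤n) (tA-jump admA t⋆≤T) ,
  shiftFrom-admissible admB (1≤tB admB t⋆≤T) (tB-jump admB t⋆≤T B0<Bt⋆) ,
  λ x _ x⋆ → mk⇔ (shifted x x⋆) (unshifted x x⋆)
  where
  A⋆ B⋆ : ℕ → ℤ
  A⋆ = shiftFrom (tA T A (suc p)) A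
  B⋆ = shiftFrom (tB T B (suc p)) B

  B0<Bt⋆ : B 0 < B (suc p)
  B0<Bt⋆ = subst (_< B (suc p)) (trans (proj₁ admA) (sym (proj₁ admB)))
    (ℤₚ.≤-<-trans (admissible-mono admA z≤n (ℕₚ.<⇒≤ t⋆≤T)) Ap<Bt⋆)

  shifted : ∀ x → x (suc p) ≡ 1 → Within T A B (psum x) → Within T A⋆ B⋆ (psumExcl (suc p) x)
  shifted x x⋆ bounds t 1≤t t≤T =
    lower-shift⇒ x x⋆ (t⋆≤tA admA t⋆≤T) (tA-plateau admA t⋆≤T)
      (within⇒lower-bound (proj₁ admA) bounds (ℕₚ.<⇒≤ t⋆≤T)) t (proj₁ (bounds t 1≤t t≤T)) ,
    upper-shift⇒ x x⋆ (tB≤t⋆ admB t⋆≤T) (tB-plateau admB t⋆≤T)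
      (proj₂ (bounds (suc p) (s≤s z≤n) t⋆≤T)) t (proj₂ (bounds t 1≤t t≤T))

  unshifted : ∀ x → x (suc p) ≡ 1 → Within T A⋆ B⋆ (psumExcl (suc p) x) → Within T A B (psum x)
  unshifted x x⋆ bounds t 1≤t t≤T =
    lower-shift⇐ x x⋆ {A} (t⋆≤tA admA t⋆≤T) t (proj₁ (bounds t 1≤t t≤T)) ,
    upper-shift⇐ x x⋆ {B} (tB≤t⋆ admB t⋆≤T) t (proj₂ (bounds t 1≤t t≤T))
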